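{- For integers $m_1,m_2\ge 0$ define polynomials $g_{m_1,m_2}(q)$ by $g_{0,0}(q)=1$, $g_{m_1,m_2}(q)=0$ if $m_1<0$ or $m_2<0$, and \[ g_{m_1,m_2}(q)=q^{\delta(c,m_1)}g_{m_1-1,m_2}(q)+g_{m_1,m_2-1}(q),\qquad (m_1,m_2)\ne(0,0), \] where $c=\lfloor\frac{m_1+m_2}{2}\rfloor+1$ and $\delta$ is the Kronecker delta. Let \[ \tilde G(z,u,q)=\sum_{m_1,m_2\ge 0} g_{m_1,m_2}(q)\,z^{m_1+m_2}u^{m_2-m_1}. \] Then \[ \tilde G(z,u,q)=\frac{\big(2qu^2z+(q-1)^2u-q(q-1)z\big)P(z^2)-zu\big(u+q(q-1)z\big)}{zu\,(zu^2-u+z)\,\big(1-2qP(z^2)\big)}, \] where $P(t)=\frac{1-\sqrt{1-4t}}{2}=\sum_{n\ge1}\frac1n\binom{2n-2}{n-1}t^n$. -}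

module Defs where

open import Level using (Level)
open import Data.Nat as ℕ using (ℕ; zero; suc; _∸_; _/_)
open import Data.Nat.Combinatorics using (_C_)
open import Data.Bool using (if_then_else_)
open import Algebra.Bundles using (CommutativeRing)

-- Formal power series in z with coefficients in a commutative ring R:
-- a series is its coefficient function  n ↦ [z^n].
module Series {c ℓ : Level} (R : CommutativeRing c ℓ) where
  open CommutativeRing R hiding (zero)

  Ser : Set c
  Ser = ℕ → Carrier

  ι : ℕ → Carrier
  ι zero    = 0#
  ι (suc n) = 1# + ι n

  pow : Carrier → ℕ → Carrier
  pow x zero    = 1#
  pow x (suc n) = x * pow x n

  sumTo : (ℕ → Carrier) → ℕ → Carrier
  sumTo f zero    = f zero
  sumTo f (suc n) = sumTo f n + f (suc n)

  const : Carrier → Ser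
  const a zero    = a
  const a (suc n) = 0#

  Z : Ser
  Z zero          = 0#
  Z (suc zero)    = 1#
  Z (suc (suc n)) = 0#

  _⊕_ : Ser → Ser → Ser
  (f ⊕ g) n = f n + g n

  _⊖_ : Ser → Ser → Ser
  (f ⊖ g) n = f n - g n

  _⊛_ : Ser → Ser → Ser
  (f ⊛ g) n = sumTo (λ i → f i * g (n ∸ i)) n

  infixl 6 _⊕_ _⊖_
  infixl 7 _⊛_

  -- P(t) = Σ_{n≥1} (1/n) binom(2n-2, n-1) t^n ; the series P(z^2):
  -- [z^{2(m+1)}] P(z^2) = binom(2m, m)/(m+1), all other coefficients 0.
  Pz² : Ser
  Pz² zero = 0#
  Pz² (suc zero) = 0#
  Pz² (suc (suc k)) = Pz²' k
    where
    -- coefficient of z^(k+2)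
    Pz²' : ℕ → Carrier
    Pz²' k with k ℕ.% 2
    ... | zero  = let m = k / 2 in ι (((2 ℕ.* m) C m) / suc m)
    ... | suc _ = 0#

  module _ (q : Carrier) where

    qδ : ℕ → ℕ → Carrier
    qδ m₁ m₂ = if (suc ((m₁ ℕ.+ m₂) / 2) ℕ.≡ᵇ m₁) then q else 1#

    -- g_{m₁,m₂}(q), with g = 0 for negative indices
    g : ℕ → ℕ → Carrier
    g zero    zero    = 1#
    g (suc a) zero    = qδ (suc a) zero * g a zero
    g zero    (suc b) = g zero b
    g (suc a) (suc b) = qδ (suc a) (suc b) * g a (suc b) + g (suc a) b

    -- Given also u and its inverse v = u⁻¹ (u^{m₂-m₁} = u^{m₂} v^{m₁}):
    -- G̃(z,u,q) = Σ g_{m₁,m₂} z^{m₁+m₂} u^{m₂-m₁}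
    G̃ : Carrier → Carrier → Ser
    G̃ u v n = sumTo (λ m₁ → g m₁ (n ∸ m₁) * (pow u (n ∸ m₁) * pow v m₁)) n

    Num : Carrier → Ser
    Num u =
      (const (ι 2 * q * u * u) ⊛ Z ⊕ const ((q - 1#) * (q - 1#) * u)
        ⊖ const (q * (q - 1#)) ⊛ Z) ⊛ Pz²
      ⊖ Z ⊛ const u ⊛ (const u ⊕ const (q * (q - 1#)) ⊛ Z)

    Den : Carrier → Ser
    Den u =
      Z ⊛ const u ⊛ (Z ⊛ const (u * u) ⊖ const u ⊕ Z)
        ⊛ (const 1# ⊖ const (ι 2 * q) ⊛ Pz²)

-- The statement of Theorem 7 with denominators cleared, over an arbitrary
-- commutative ring R (q, u ∈ R, v = u⁻¹), coefficientwise in z.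
Thm7 : ∀ {c ℓ : Level} (R : CommutativeRing c ℓ) → Set _
Thm7 R = (q u v : Carrier) → u * v ≈ 1# →
  ∀ (n : ℕ) → (G̃ q u v ⊛ Den q u) n ≈ Num q u n
  where
  open CommutativeRing R hiding (zero)
  open Series R

module Submission where

open import Level using (Level)
open import Algebra.Bundles using (CommutativeRing)
open import Algebra.Solver.Ring.AlmostCommutativeRing using (_-Raw-AlmostCommutative⟶_; fromCommutativeRing)
import Algebra.Solver.Ring
import Algebra.Solver.Ring.NaturalCoefficients.Default as ℕ-Solver
open import Data.Bool using (Bool; true; false; if_then_else_; T)
open import Data.Unit using (tt)
open import Data.Maybe using (Maybe; just; nothing)
open import Data.Product using (∃-syntax; _,_)
open import Data.Sum using (_⊎_; inj₁; inj₂)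
open import Data.Nat as ℕ using (ℕ; zero; suc; _∸_; _≤_; _<_; z≤n; s≤s; _/_; _%_; _≡ᵇ_; parity)
import Data.Nat.Properties as ℕ
open import Data.Nat.DivMod using (m/n≡1+[m∸n]/n; m/n<m; m≡m%n+[m/n]*n; m%n<n)
open import Data.Nat.Combinatorics using (_C_; k>n⇒nCk≡0)
open import Data.Nat.Induction using (<-rec)
open import Data.Parity using (1ℙ)
open import Data.Integer as ℤ using (ℤ; +_; -[1+_]; ∣_∣; _◃_; sign)
open import Data.Integer.Base using (_⊖_)
import Data.Integer.Properties as ℤ
open import Data.Sign as Sign using (Sign)
open import Relation.Binary.PropositionalEquality as ≡ using (_≡_; _≢_)
open import Relation.Nullary using (yes; no; contradiction)
open import Defs

-- Read g_{m₁,m₂}(q) as the total weight of the ±1-walks of length m₁ + m₂ from level m₁ - m₂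
-- to 0 in which a down-step from level 1 or 2 weighs q: these are exactly the steps where
-- δ(c, m₁) = 1.  Let Fₗ be the generating function of the walks from level ℓ, A = F₀, B = F₁,
-- and P = P(z²), so that P = z² + P² (P/z² counts Dyck paths, by the ballot numbers).
-- Cutting a walk at its first visit to the next level towards 0 gives z F₂ = q P B and
-- z F₋₁ = P A, and with the first-step equations A = 1 + z (B + F₋₁), B = z (F₂ + q A),
--   z² (1 - 2qP) A = q z² + (1 - q) P,      z (1 - 2qP) B = q P.
-- In the recurrence of the coefficients of G̃ the weight q occurs only on the terms nearest
-- to the diagonal, which are those of A and B:
--   G̃ = 1 + z (u + u⁻¹) G̃ + z u⁻¹ (q - 1) (A + u⁻¹ B),
-- and eliminating A and B gives the closed form.

module Arithmetic where

  [2+n]/2≡1+n/2 : ∀ n → suc (suc n) / 2 ≡ suc (n / 2)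
  [2+n]/2≡1+n/2 n = m/n≡1+[m∸n]/n {suc (suc n)} {2} (s≤s (s≤s z≤n))

  [m+m]/2≡m : ∀ m → (m ℕ.+ m) / 2 ≡ m
  [m+m]/2≡m zero    = ≡.refl
  [m+m]/2≡m (suc m) = ≡.trans (≡.cong (λ k → suc k / 2) (ℕ.+-suc m m))
                              (≡.trans ([2+n]/2≡1+n/2 (m ℕ.+ m)) (≡.cong suc ([m+m]/2≡m m)))

  [1+m+m]/2≡m : ∀ m → suc (m ℕ.+ m) / 2 ≡ m
  [1+m+m]/2≡m zero    = ≡.refl
  [1+m+m]/2≡m (suc m) = ≡.trans (≡.cong (λ k → suc (suc k) / 2) (ℕ.+-suc m m))
                                (≡.trans ([2+n]/2≡1+n/2 (suc (m ℕ.+ m))) (≡.cong suc ([1+m+m]/2≡m m)))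

  n%2≡0⇒n≡[n/2]+[n/2] : ∀ n → n % 2 ≡ 0 → n ≡ n / 2 ℕ.+ n / 2
  n%2≡0⇒n≡[n/2]+[n/2] n n%2≡0 = begin
    n                         ≡⟨ m≡m%n+[m/n]*n n 2 ⟩
    n % 2 ℕ.+ n / 2 ℕ.* 2     ≡⟨ ≡.cong (ℕ._+ n / 2 ℕ.* 2) n%2≡0 ⟩
    n / 2 ℕ.* 2               ≡⟨ ℕ.*-comm (n / 2) 2 ⟩
    n / 2 ℕ.+ (n / 2 ℕ.+ 0)   ≡⟨ ≡.cong (n / 2 ℕ.+_) (ℕ.+-identityʳ (n / 2)) ⟩
    n / 2 ℕ.+ n / 2           ∎
    where open ≡.≡-Reasoning

  n%2≡1+j⇒n≡1+[n/2]+[n/2] : ∀ n {j} → n % 2 ≡ suc j → n ≡ suc (n / 2 ℕ.+ n / 2)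
  n%2≡1+j⇒n≡1+[n/2]+[n/2] n {j} n%2≡1+j = begin
    n                             ≡⟨ m≡m%n+[m/n]*n n 2 ⟩
    n % 2 ℕ.+ n / 2 ℕ.* 2         ≡⟨ ≡.cong (ℕ._+ n / 2 ℕ.* 2) (≡.trans n%2≡1+j (≡.cong suc j≡0)) ⟩
    suc (n / 2 ℕ.* 2)             ≡⟨ ≡.cong suc (ℕ.*-comm (n / 2) 2) ⟩
    suc (n / 2 ℕ.+ (n / 2 ℕ.+ 0)) ≡⟨ ≡.cong (λ k → suc (n / 2 ℕ.+ k)) (ℕ.+-identityʳ (n / 2)) ⟩
    suc (n / 2 ℕ.+ n / 2)         ∎
    where
    open ≡.≡-Reasoning
    j≡0 : j ≡ 0
    j≡0 = ℕ.n<1⇒n≡0 (ℕ.≤-pred (≡.subst (_< 2) n%2≡1+j (m%n<n n 2)))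

  even-or-odd : ∀ n → (∃[ m ] n ≡ m ℕ.+ m) ⊎ (∃[ m ] n ≡ suc (m ℕ.+ m))
  even-or-odd zero    = inj₁ (0 , ≡.refl)
  even-or-odd (suc n) with even-or-odd n
  ... | inj₁ (m , n≡m+m)   = inj₂ (m , ≡.cong suc n≡m+m)
  ... | inj₂ (m , n≡1+m+m) =
    inj₁ (suc m , ≡.trans (≡.cong suc n≡1+m+m) (≡.cong suc (≡.sym (ℕ.+-suc m m))))

  parity[1+m+m]≡1 : ∀ m → parity (suc (m ℕ.+ m)) ≡ 1ℙ
  parity[1+m+m]≡1 zero    = ≡.refl
  parity[1+m+m]≡1 (suc m) = ≡.trans (≡.cong parity (ℕ.+-suc m m)) (parity[1+m+m]≡1 m)

  parity-suc-level : ∀ n L → parity (n ℕ.+ ∣ ℤ.suc L ∣) ≡ parity (suc n ℕ.+ ∣ L ∣)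
  parity-suc-level n (+ k)        = ≡.cong parity (ℕ.+-suc n k)
  parity-suc-level n -[1+ zero ]  = ≡.sym (≡.cong (λ k → parity (suc k)) (ℕ.+-suc n 0))
  parity-suc-level n -[1+ suc k ] = ≡.sym (≡.cong (λ k → parity (suc k)) (ℕ.+-suc n (suc k)))

  parity-pred-level : ∀ n L → parity (n ℕ.+ ∣ ℤ.pred L ∣) ≡ parity (suc n ℕ.+ ∣ L ∣)
  parity-pred-level n (+ zero)  = ≡.cong parity (ℕ.+-suc n 0)
  parity-pred-level n (+ suc k) = ≡.sym (≡.cong (λ k → parity (suc k)) (ℕ.+-suc n k))
  parity-pred-level n -[1+ k ]  = ≡.cong parity (ℕ.+-suc n (suc k))

  ≡ᵇ-refl : ∀ n → (n ≡ᵇ n) ≡ true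
  ≡ᵇ-refl zero    = ≡.refl
  ≡ᵇ-refl (suc n) = ≡ᵇ-refl n

  ≢⇒≡ᵇ-false : ∀ {m n} → m ≢ n → (m ≡ᵇ n) ≡ false
  ≢⇒≡ᵇ-false {m} {n} m≢n with m ≡ᵇ n in eq
  ... | false = ≡.refl
  ... | true  = contradiction (ℕ.≡ᵇ⇒≡ m n (≡.subst T (≡.sym eq) tt)) m≢n

  isSpecial : ℤ → Bool
  isSpecial (+ 1) = true
  isSpecial (+ 2) = true
  isSpecial _     = false

  δ-condition≡isSpecial : ∀ m₁ m₂ → (suc ((m₁ ℕ.+ m₂) / 2) ≡ᵇ m₁) ≡ isSpecial (m₁ ⊖ m₂)
  δ-condition≡isSpecial zero                zero    = ≡.refl
  δ-condition≡isSpecial zero                (suc _) = ≡.refl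
  δ-condition≡isSpecial (suc zero)          zero    = ≡.refl
  δ-condition≡isSpecial (suc (suc zero))    zero    = ≡.refl
  δ-condition≡isSpecial (suc (suc (suc a))) zero    = begin
    (suc (suc (suc (suc a ℕ.+ 0)) / 2) ≡ᵇ suc (suc (suc a)))
      ≡⟨ ≡.cong (λ k → suc k ≡ᵇ suc (suc (suc a))) ([2+n]/2≡1+n/2 (suc a ℕ.+ 0)) ⟩
    ((suc a ℕ.+ 0) / 2 ≡ᵇ suc a)
      ≡⟨ ≢⇒≡ᵇ-false (ℕ.<⇒≢ half<1+a) ⟩
    false ∎
    where
    open ≡.≡-Reasoning
    half<1+a : (suc a ℕ.+ 0) / 2 < suc a
    half<1+a = ≡.subst (λ k → k / 2 < suc a) (≡.sym (ℕ.+-identityʳ (suc a)))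
                       (m/n<m (suc a) 2 (s≤s (s≤s z≤n)))
  δ-condition≡isSpecial (suc a) (suc b) = begin
    (suc ((suc a ℕ.+ suc b) / 2) ≡ᵇ suc a)
      ≡⟨ ≡.cong (λ k → suc (suc k / 2) ≡ᵇ suc a) (ℕ.+-suc a b) ⟩
    (suc (suc (suc (a ℕ.+ b)) / 2) ≡ᵇ suc a)
      ≡⟨ ≡.cong (λ k → suc k ≡ᵇ suc a) ([2+n]/2≡1+n/2 (a ℕ.+ b)) ⟩
    (suc ((a ℕ.+ b) / 2) ≡ᵇ a)
      ≡⟨ δ-condition≡isSpecial a b ⟩
    isSpecial (a ⊖ b)
      ≡⟨ ≡.cong isSpecial (ℤ.[1+m]⊖[1+n]≡m⊖n a b) ⟨
    isSpecial (suc a ⊖ suc b) ∎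
    where open ≡.≡-Reasoning

open Arithmetic

module Binomial where
  open import Data.Nat.Base using (_+_; _*_)
  open import Data.Nat.Properties
  open import Data.Nat.Solver using (module +-*-Solver)
  open import Data.Nat.Combinatorics using (nCk+nC[k+1]≡[n+1]C[k+1]; nC1≡n; nCk≡nC[n∸k])
  open import Data.Nat.DivMod using (m*n/n≡m)
  open import Relation.Binary.PropositionalEquality using (refl; sym; trans; cong; cong₂; subst; module ≡-Reasoning)
  open +-*-Solver using (solve; _:+_; _:*_; _:=_; con)

  pascal : ∀ n k → suc n C suc k ≡ n C k + n C suc k
  pascal n k = sym (nCk+nC[k+1]≡[n+1]C[k+1] n k)

  absorption : ∀ n k → suc k * (suc n C suc k) ≡ suc n * (n C k)
  absorption zero    zero    = refl
  absorption zero    (suc k) = *-zeroʳ (suc (suc k))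
  absorption (suc n) zero    = trans (+-identityʳ _) (trans (nC1≡n (suc (suc n))) (sym (*-identityʳ _)))
  absorption (suc n) (suc k) = begin
    (2 + k) * (suc (suc n) C suc (suc k))
      ≡⟨ cong ((2 + k) *_) (pascal (suc n) (suc k)) ⟩
    (2 + k) * (a + b)
      ≡⟨ solve 3 (λ k a b → (con 2 :+ k) :* (a :+ b) := a :+ ((con 1 :+ k) :* a :+ (con 2 :+ k) :* b)) refl k a b ⟩
    a + ((1 + k) * a + (2 + k) * b)
      ≡⟨ cong₂ (λ x y → a + (x + y)) (absorption n k) (absorption n (suc k)) ⟩
    a + ((1 + n) * (n C k) + (1 + n) * (n C suc k))
      ≡⟨ cong (λ x → a + x) (*-distribˡ-+ (suc n) (n C k) (n C suc k)) ⟨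
    a + (1 + n) * (n C k + n C suc k)
      ≡⟨ cong (λ x → a + (1 + n) * x) (pascal n k) ⟨
    a + (1 + n) * a ∎
    where
    open ≡-Reasoning
    a = suc n C suc k
    b = suc n C suc (suc k)

  middle-symmetry : ∀ m → (m + suc m) C suc m ≡ (m + suc m) C m
  middle-symmetry m = sym (trans (nCk≡nC[n∸k] (m≤m+n m (suc m))) (cong ((m + suc m) C_) (m+n∸m≡n m (suc m))))

  central-balance : ∀ m → m * ((m + m) C m) ≡ suc m * ((m + m) C suc m)
  central-balance zero    = refl
  central-balance (suc k) = begin
    suc k * (suc n C suc k)         ≡⟨ absorption n k ⟩
    suc n * (n C k)                 ≡⟨ cong (suc n *_) (middle-symmetry k) ⟨
    suc n * (n C suc k)             ≡⟨ absorption n (suc k) ⟨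
    suc (suc k) * (suc n C suc (suc k)) ∎
    where
    open ≡-Reasoning
    n = k + suc k

  catalan : ∀ m → ((2 * m) C m) / suc m + (m + m) C suc m ≡ (m + m) C m
  catalan m = begin
    ((2 * m) C m) / suc m + Y ≡⟨ cong (λ k → (k C m) / suc m + Y) (cong (λ x → m + x) (+-identityʳ m)) ⟩
    X / suc m + Y             ≡⟨ cong (λ k → k / suc m + Y) (X≡[X∸Y]*[1+m]) ⟩
    (X ∸ Y) * suc m / suc m + Y ≡⟨ cong (_+ Y) (m*n/n≡m (X ∸ Y) (suc m)) ⟩
    (X ∸ Y) + Y               ≡⟨ m∸n+n≡m Y≤X ⟩
    X                         ∎
    where
    open ≡-Reasoning
    X = (m + m) C m
    Y = (m + m) C suc m
    Y≤X : Y ≤ X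
    Y≤X = *-cancelˡ-≤ (suc m) (subst (_≤ suc m * X) (central-balance m) (*-monoˡ-≤ X (n≤1+n m)))
    X≡[X∸Y]*[1+m] : X ≡ (X ∸ Y) * suc m
    X≡[X∸Y]*[1+m] = sym (begin
      (X ∸ Y) * suc m           ≡⟨ *-distribʳ-∸ (suc m) X Y ⟩
      X * suc m ∸ Y * suc m     ≡⟨ cong₂ _∸_ (*-comm X (suc m)) (*-comm Y (suc m)) ⟩
      X + m * X ∸ suc m * Y     ≡⟨ cong (X + m * X ∸_) (central-balance m) ⟨
      X + m * X ∸ m * X         ≡⟨ m+n∸n≡m X (m * X) ⟩
      X                         ∎)

-- The ring solver over an arbitrary commutative ring, with integer coefficients: unlike the
-- solver with natural-number coefficients, it normalises x - x to 0.
module IntegerCoefficients {c ℓ} (R : CommutativeRing c ℓ) where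
  open CommutativeRing R hiding (zero)
  open import Relation.Binary.Reasoning.Setoid setoid
  open import Algebra.Properties.Ring ring using (-1*x≈-x; -0#≈0#; -‿involutive)
  open import Algebra.Properties.AbelianGroup +-abelianGroup using (⁻¹-∙-comm)
  open import Algebra.Properties.Semiring.Mult.TCOptimised semiring using (_×_; 1+×; ×-homo-+; ×1-homo-*)
  open ℕ-Solver commutativeSemiring using (solve; _:+_; _:*_; _:=_)

  ⟦_⟧ : ℤ → Carrier
  ⟦ + n      ⟧ = n × 1#
  ⟦ -[1+ n ] ⟧ = - (suc n × 1#)

  ⊖-homo : ∀ m n → ⟦ m ℤ.⊖ n ⟧ ≈ m × 1# - n × 1#
  ⊖-homo m zero rewrite ℤ.⊖-≥ {m} {0} ℕ.z≤n = sym (trans (+-congˡ -0#≈0#) (+-identityʳ _))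
  ⊖-homo zero (suc n) rewrite ℤ.⊖-≤ {0} {suc n} ℕ.z≤n = sym (+-identityˡ _)
  ⊖-homo (suc m) (suc n) rewrite ℤ.[1+m]⊖[1+n]≡m⊖n m n = begin
    ⟦ m ℤ.⊖ n ⟧                   ≈⟨ ⊖-homo m n ⟩
    m′ - n′                       ≈⟨ +-identityˡ _ ⟨
    0# + (m′ - n′)                ≈⟨ +-congʳ (-‿inverseʳ 1#) ⟨
    (1# - 1#) + (m′ - n′)         ≈⟨ solve 4 (λ a b x y → (a :+ b) :+ (x :+ y) := (a :+ x) :+ (b :+ y))
                                       refl 1# (- 1#) m′ (- n′) ⟩
    (1# + m′) + (- 1# - n′)       ≈⟨ +-cong (sym (1+× m 1#)) (⁻¹-∙-comm 1# n′) ⟩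
    suc m × 1# - (1# + n′)        ≈⟨ +-congˡ (-‿cong (1+× n 1#)) ⟨
    suc m × 1# - suc n × 1#       ∎
    where m′ = m × 1#; n′ = n × 1#

  +-homo : ∀ i j → ⟦ i ℤ.+ j ⟧ ≈ ⟦ i ⟧ + ⟦ j ⟧
  +-homo (+ m)    (+ n)    = ×-homo-+ 1# m n
  +-homo (+ m)    -[1+ n ] = ⊖-homo m (suc n)
  +-homo -[1+ m ] (+ n)    = trans (⊖-homo n (suc m)) (+-comm _ _)
  +-homo -[1+ m ] -[1+ n ] = begin
    - (suc (suc (m ℕ.+ n)) × 1#)     ≈⟨ -‿cong (reflexive (≡.cong (λ k → suc k × 1#) (ℕ.+-suc m n))) ⟨
    - ((suc m ℕ.+ suc n) × 1#)       ≈⟨ -‿cong (×-homo-+ 1# (suc m) (suc n)) ⟩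
    - (suc m × 1# + suc n × 1#)      ≈⟨ ⁻¹-∙-comm _ _ ⟨
    - (suc m × 1#) + - (suc n × 1#)  ∎

  σ : Sign → Carrier
  σ Sign.+ = 1#
  σ Sign.- = - 1#

  σ-homo : ∀ s t → σ (s Sign.* t) ≈ σ s * σ t
  σ-homo Sign.+ t       = sym (*-identityˡ _)
  σ-homo Sign.- Sign.+  = sym (*-identityʳ _)
  σ-homo Sign.- Sign.-  = sym (trans (-1*x≈-x _) (-‿involutive _))

  ◃-homo : ∀ s n → ⟦ s ◃ n ⟧ ≈ σ s * (n × 1#)
  ◃-homo s      zero    = sym (zeroʳ _)
  ◃-homo Sign.+ (suc n) = sym (*-identityˡ _)
  ◃-homo Sign.- (suc n) = sym (-1*x≈-x _)

  sign-abs : ∀ i → ⟦ i ⟧ ≈ σ (sign i) * (∣ i ∣ × 1#)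
  sign-abs i = trans (reflexive (≡.cong ⟦_⟧ (≡.sym (ℤ.◃-inverse i)))) (◃-homo (sign i) ∣ i ∣)

  *-homo : ∀ i j → ⟦ i ℤ.* j ⟧ ≈ ⟦ i ⟧ * ⟦ j ⟧
  *-homo i j = begin
    ⟦ (sign i Sign.* sign j) ◃ (∣ i ∣ ℕ.* ∣ j ∣) ⟧
      ≈⟨ ◃-homo _ (∣ i ∣ ℕ.* ∣ j ∣) ⟩
    σ (sign i Sign.* sign j) * ((∣ i ∣ ℕ.* ∣ j ∣) × 1#)
      ≈⟨ *-cong (σ-homo (sign i) (sign j)) (×1-homo-* ∣ i ∣ ∣ j ∣) ⟩
    (σ (sign i) * σ (sign j)) * (∣ i ∣ × 1# * ∣ j ∣ × 1#)
      ≈⟨ solve 4 (λ a b x y → (a :* b) :* (x :* y) := (a :* x) :* (b :* y)) refl _ _ _ _ ⟩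
    (σ (sign i) * ∣ i ∣ × 1#) * (σ (sign j) * ∣ j ∣ × 1#)
      ≈⟨ *-cong (sign-abs i) (sign-abs j) ⟨
    ⟦ i ⟧ * ⟦ j ⟧ ∎

  -‿homo : ∀ i → ⟦ ℤ.- i ⟧ ≈ - ⟦ i ⟧
  -‿homo (+ zero)  = sym -0#≈0#
  -‿homo (+ suc n) = refl
  -‿homo -[1+ n ]  = sym (-‿involutive _)

  ℤ⟶R : ℤ.+-*-rawRing -Raw-AlmostCommutative⟶ fromCommutativeRing R
  ℤ⟶R = record
    { ⟦_⟧ = ⟦_⟧ ; +-homo = +-homo ; *-homo = *-homo ; -‿homo = -‿homo
    ; 0-homo = refl ; 1-homo = refl }

  _≟ᶜ_ : ∀ i j → Maybe (⟦ i ⟧ ≈ ⟦ j ⟧)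
  i ≟ᶜ j with i ℤ.≟ j
  ... | yes ≡.refl = just refl
  ... | no _       = nothing

  open Algebra.Solver.Ring ℤ.+-*-rawRing (fromCommutativeRing R) ℤ⟶R _≟ᶜ_
    public using (Polynomial; solve; _:=_; _:+_; _:*_; _:-_; con)

module Identities {c ℓ} (S : CommutativeRing c ℓ) where
  open CommutativeRing S
  open IntegerCoefficients S using (Polynomial; solve; _:=_; _:+_; _:*_; _:-_; con)
  open import Relation.Binary.Reasoning.Setoid setoid

  private
    :1 :2 : ∀ {n} → Polynomial n
    :1 = con (+ 1)
    :2 = con (+ 2)

  -- Each identity below is a polynomial consequence of its hypotheses: the solver proves
  -- x + r = y + l, where l ≈ r is the suitable linear combination of the hypotheses.
  cancel-via : ∀ {x y l r} → x + r ≈ y + l → l ≈ r → x ≈ y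
  cancel-via {x} {y} {l} {r} x+r≈y+l l≈r = begin
    x               ≈⟨ solve 2 (λ x r → x := x :+ r :- r) refl x r ⟩
    x + r - r       ≈⟨ +-congʳ x+r≈y+l ⟩
    y + l - r       ≈⟨ +-congʳ (+-congˡ l≈r) ⟩
    y + r - r       ≈⟨ solve 2 (λ y r → y :+ r :- r := y) refl y r ⟩
    y               ∎

  catalan-equation : ∀ {z e} → e ≈ 1# + z * (z * (e * e)) →
                     z * (z * e) ≈ z * z + z * (z * e) * (z * (z * e))
  catalan-equation {z} {e} e-eq = cancel-via
    (solve 2 (λ z e → z :* (z :* e) :+ z :* z :* (:1 :+ z :* (z :* (e :* e)))
                   := z :* z :+ z :* (z :* e) :* (z :* (z :* e)) :+ z :* z :* e) refl z e)
    (*-congˡ e-eq)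

  first-passage-step : ∀ {z p c x y x′} → p ≈ z * z + p * p → y ≈ z * (x′ + c * x) →
                       z * y - c * (p * x) ≈ p * (z * y - c * (p * x)) + z * (z * x′ - p * y)
  first-passage-step {z} {p} {c} {x} {y} {x′} p-eq y-eq = cancel-via
    (solve 6 (λ z p c x y x′ →
        z :* y :- c :* (p :* x) :+ (z :* (z :* (x′ :+ c :* x)) :+ c :* x :* p)
          := p :* (z :* y :- c :* (p :* x)) :+ z :* (z :* x′ :- p :* y) :+ (z :* y :+ c :* x :* (z :* z :+ p :* p)))
      refl z p c x y x′)
    (+-cong (*-congˡ y-eq) (*-congˡ (sym p-eq)))

  module Elimination {z p q a b f f₂} (p-eq : p ≈ z * z + p * p)
           (a-eq : a ≈ 1# + z * (b + f)) (f-eq : z * f ≈ p * a)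
           (b-eq : b ≈ z * (f₂ + q * a)) (f₂-eq : z * f₂ ≈ q * (p * b)) where

    private
      a-step : (1# - p) * a ≈ 1# + z * b
      a-step = cancel-via
        (solve 5 (λ z p a b f → (:1 :- p) :* a :+ (:1 :+ z :* (b :+ f) :+ p :* a)
                             := :1 :+ z :* b :+ (a :+ z :* f)) refl z p a b f)
        (+-cong a-eq f-eq)

      b-step : (1# - q * p) * (z * b) ≈ q * (z * z) * a
      b-step = cancel-via
        (solve 6 (λ z p q a b f₂ → (:1 :- q :* p) :* (z :* b) :+ (z :* (z :* (f₂ :+ q :* a)) :+ z :* (q :* (p :* b)))
                                 := q :* (z :* z) :* a :+ (z :* b :+ z :* (z :* f₂)))
               refl z p q a b f₂)
        (+-cong (*-congˡ b-eq) (*-congˡ f₂-eq))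

    a-solution : z * z * (1# - (1# + 1#) * q * p) * a ≈ q * z * z + (1# - q) * p
    a-solution = cancel-via
      (solve 5 (λ z p q a b →
          z :* z :* (:1 :- :2 :* q :* p) :* a
            :+ (p :* (:1 :- q :* p) :* (:1 :+ z :* b) :+ p :* (q :* (z :* z) :* a)
                :+ ((:1 :- q :* p) :* a :- q) :* p)
          := q :* z :* z :+ (:1 :- q) :* p
            :+ (p :* (:1 :- q :* p) :* ((:1 :- p) :* a) :+ p :* ((:1 :- q :* p) :* (z :* b))
                :+ ((:1 :- q :* p) :* a :- q) :* (z :* z :+ p :* p)))
        refl z p q a b)
      (+-cong (+-cong (*-congˡ a-step) (*-congˡ b-step)) (*-congˡ (sym p-eq)))

    b-solution : z * (1# - (1# + 1#) * q * p) * b ≈ q * p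
    b-solution = cancel-via
      (solve 5 (λ z p q a b →
          z :* (:1 :- :2 :* q :* p) :* b
            :+ (q :* p :* (:1 :+ z :* b) :+ q :* (z :* z) :* a :+ q :* a :* p)
          := q :* p
            :+ (q :* p :* ((:1 :- p) :* a) :+ (:1 :- q :* p) :* (z :* b) :+ q :* a :* (z :* z :+ p :* p)))
        refl z p q a b)
      (+-cong (+-cong (*-congˡ a-step) b-step) (*-congˡ (sym p-eq)))

  -- multiply the equation for g by z u² (1 - 2qp) and eliminate u v, a and b
  closed-form : ∀ {z p q u v g a b} → u * v ≈ 1# →
    g ≈ 1# + z * (u * g + v * g + v * ((q - 1#) * (a + v * b))) →
    z * z * (1# - (1# + 1#) * q * p) * a ≈ q * z * z + (1# - q) * p →
    z * (1# - (1# + 1#) * q * p) * b ≈ q * p →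
    g * (z * u * (z * (u * u) - u + z) * (1# - (1# + 1#) * q * p))
      ≈ ((1# + 1#) * q * u * u * z + (q - 1#) * (q - 1#) * u - q * (q - 1#) * z) * p
        - z * u * (u + q * (q - 1#) * z)
  closed-form {z} {p} {q} {u} {v} {g} {a} {b} uv≈1 g-eq a-eq b-eq = cancel-via
    (solve 8 (λ z p q u v g a b →
       let K = :1 :- :2 :* q :* p
           r = q :- :1
           c₁ = z :* u :* u :* K
           c₂ = z :* z :* u :* K :* g :+ z :* z :* u :* r :* K :* a :+ z :* z :* r :* K :* b :* (u :* v :+ :1)
           c₃ = u :* r
           c₄ = z :* r
       in g :* (z :* u :* (z :* (u :* u) :- u :+ z) :* K)
            :+ (c₁ :* g :+ c₂ :* (u :* v) :+ c₃ :* (z :* z :* K :* a) :+ c₄ :* (z :* K :* b))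
          := (:2 :* q :* u :* u :* z :+ r :* r :* u :- q :* r :* z) :* p :- z :* u :* (u :+ q :* r :* z)
            :+ (c₁ :* (:1 :+ z :* (u :* g :+ v :* g :+ v :* (r :* (a :+ v :* b))))
                :+ c₂ :* :1 :+ c₃ :* (q :* z :* z :+ (:1 :- q) :* p) :+ c₄ :* (q :* p)))
      refl z p q u v g a b)
    (+-cong (+-cong (+-cong (*-congˡ (sym g-eq)) (*-congˡ (sym uv≈1))) (*-congˡ (sym a-eq))) (*-congˡ (sym b-eq)))

module PowerSeries {c ℓ} (R : CommutativeRing c ℓ) where
  open CommutativeRing R hiding (zero)
  open Series R
  open import Relation.Binary.Reasoning.Setoid setoid
  open import Algebra.Properties.Ring ring using (-0#≈0#)
  open IntegerCoefficients R using (solve; _:=_; _:+_; _:*_)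

  infix 4 _≋_
  _≋_ : Ser → Ser → Set ℓ
  f ≋ g = ∀ n → f n ≈ g n

  sumTo-cong : ∀ {f g} n → (∀ i → i ≤ n → f i ≈ g i) → sumTo f n ≈ sumTo g n
  sumTo-cong zero    f≈g = f≈g 0 z≤n
  sumTo-cong (suc n) f≈g =
    +-cong (sumTo-cong n (λ i i≤n → f≈g i (ℕ.m≤n⇒m≤1+n i≤n))) (f≈g (suc n) ℕ.≤-refl)

  sumTo-+ : ∀ f g n → sumTo (λ i → f i + g i) n ≈ sumTo f n + sumTo g n
  sumTo-+ f g zero    = refl
  sumTo-+ f g (suc n) = trans (+-congʳ (sumTo-+ f g n))
    (solve 4 (λ a b x y → (a :+ b) :+ (x :+ y) := (a :+ x) :+ (b :+ y)) refl _ _ _ _)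

  sumTo-*ˡ : ∀ a f n → a * sumTo f n ≈ sumTo (λ i → a * f i) n
  sumTo-*ˡ a f zero    = refl
  sumTo-*ˡ a f (suc n) = trans (distribˡ a _ _) (+-congʳ (sumTo-*ˡ a f n))

  sumTo-zero : ∀ n → sumTo (λ _ → 0#) n ≈ 0#
  sumTo-zero zero    = refl
  sumTo-zero (suc n) = trans (+-identityʳ _) (sumTo-zero n)

  sumTo-suc : ∀ f n → sumTo f (suc n) ≈ f 0 + sumTo (λ i → f (suc i)) n
  sumTo-suc f zero    = refl
  sumTo-suc f (suc n) = trans (+-congʳ (sumTo-suc f n)) (+-assoc _ _ _)

  sumTo-reverse : ∀ f n → sumTo f n ≈ sumTo (λ i → f (n ∸ i)) n
  sumTo-reverse f zero    = refl
  sumTo-reverse f (suc n) = begin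
    sumTo f n + f (suc n)                   ≈⟨ +-congʳ (sumTo-reverse f n) ⟩
    sumTo (λ i → f (n ∸ i)) n + f (suc n)   ≈⟨ +-comm _ _ ⟩
    f (suc n) + sumTo (λ i → f (n ∸ i)) n   ≈⟨ sumTo-suc (λ i → f (suc n ∸ i)) n ⟨
    sumTo (λ i → f (suc n ∸ i)) (suc n)     ∎

  δ : ℕ → Carrier → ℕ → Carrier
  δ i r j = if i ≡ᵇ j then r else 0#

  δ-≢ : ∀ {i j} r → i ≢ j → δ i r j ≡ 0#
  δ-≢ r i≢j = ≡.cong (if_then r else 0#) (≢⇒≡ᵇ-false i≢j)

  sumTo-δ-vanishes : ∀ i r (f : ℕ → Carrier) n → n < i → sumTo (λ j → δ i r j * f j) n ≈ 0#
  sumTo-δ-vanishes i r f zero    0<i = trans (*-congʳ (reflexive (δ-≢ r (ℕ.>⇒≢ 0<i)))) (zeroˡ _)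
  sumTo-δ-vanishes i r f (suc n) n<i = begin
    sumTo (λ j → δ i r j * f j) n + δ i r (suc n) * f (suc n)
      ≈⟨ +-cong (sumTo-δ-vanishes i r f n (ℕ.<-trans (ℕ.n<1+n n) n<i))
                (*-congʳ (reflexive (δ-≢ r (ℕ.>⇒≢ n<i)))) ⟩
    0# + 0# * f (suc n)
      ≈⟨ trans (+-identityˡ _) (zeroˡ _) ⟩
    0# ∎

  sumTo-δ : ∀ i r (f : ℕ → Carrier) n → i ≤ n → sumTo (λ j → δ i r j * f j) n ≈ r * f i
  sumTo-δ i r f zero    z≤n  = refl
  sumTo-δ i r f (suc n) i≤1+n with i ℕ.≟ suc n
  ... | yes ≡.refl = begin
    sumTo (λ j → δ (suc n) r j * f j) n + δ (suc n) r (suc n) * f (suc n)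
      ≈⟨ +-cong (sumTo-δ-vanishes (suc n) r f n (ℕ.n<1+n n))
                (*-congʳ (reflexive (≡.cong (if_then r else 0#) (≡ᵇ-refl n)))) ⟩
    0# + r * f (suc n)
      ≈⟨ +-identityˡ _ ⟩
    r * f (suc n) ∎
  ... | no i≢1+n = begin
    sumTo (λ j → δ i r j * f j) n + δ i r (suc n) * f (suc n)
      ≈⟨ +-cong (sumTo-δ i r f n (ℕ.≤-pred (ℕ.≤∧≢⇒< i≤1+n i≢1+n)))
                (*-congʳ (reflexive (δ-≢ r i≢1+n))) ⟩
    r * f i + 0# * f (suc n)
      ≈⟨ trans (+-congˡ (zeroˡ _)) (+-identityʳ _) ⟩
    r * f i ∎

  ⊛-cong : ∀ {f f′ g g′} → f ≋ f′ → g ≋ g′ → f ⊛ g ≋ f′ ⊛ g′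
  ⊛-cong f≋f′ g≋g′ n = sumTo-cong n (λ i _ → *-cong (f≋f′ i) (g≋g′ (n ∸ i)))

  ⊛-suc : ∀ f g n → (f ⊛ g) (suc n) ≈ f 0 * g (suc n) + ((λ i → f (suc i)) ⊛ g) n
  ⊛-suc f g n = sumTo-suc (λ i → f i * g (suc n ∸ i)) n

  ⊛-distribʳ : ∀ f g h → (f ⊕ g) ⊛ h ≋ f ⊛ h ⊕ g ⊛ h
  ⊛-distribʳ f g h n = trans (sumTo-cong n (λ i _ → distribʳ _ _ _)) (sumTo-+ _ _ n)

  ⊛-scaleˡ : ∀ a f g n → ((λ i → a * f i) ⊛ g) n ≈ a * (f ⊛ g) n
  ⊛-scaleˡ a f g n = trans (sumTo-cong n (λ i _ → *-assoc _ _ _)) (sym (sumTo-*ˡ a _ n))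

  ⊛-comm : ∀ f g → f ⊛ g ≋ g ⊛ f
  ⊛-comm f g n = trans (sumTo-reverse _ n) (sumTo-cong n (λ i i≤n →
    trans (*-comm _ _) (*-congʳ (reflexive (≡.cong g (ℕ.m∸[m∸n]≡n i≤n))))))

  ⊛-assoc : ∀ f g h → (f ⊛ g) ⊛ h ≋ f ⊛ (g ⊛ h)
  ⊛-assoc f g h zero    = *-assoc _ _ _
  ⊛-assoc f g h (suc n) = begin
    ((f ⊛ g) ⊛ h) (suc n)
      ≈⟨ ⊛-suc (f ⊛ g) h n ⟩
    (f ⊛ g) 0 * h (suc n) + ((λ i → (f ⊛ g) (suc i)) ⊛ h) n
      ≈⟨ +-congˡ (trans (⊛-cong {g = h} (⊛-suc f g) (λ _ → refl) n)
                        (⊛-distribʳ f₀g′ (f′ ⊛ g) h n)) ⟩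
    (f 0 * g 0) * h (suc n) + ((f₀g′ ⊛ h) n + ((f′ ⊛ g) ⊛ h) n)
      ≈⟨ +-congˡ (+-cong (⊛-scaleˡ (f 0) g′ h n) (⊛-assoc f′ g h n)) ⟩
    (f 0 * g 0) * h (suc n) + (f 0 * (g′ ⊛ h) n + (f′ ⊛ (g ⊛ h)) n)
      ≈⟨ solve 5 (λ a b c x y → (a :* b) :* c :+ (a :* x :+ y) := a :* (b :* c :+ x) :+ y) refl _ _ _ _ _ ⟩
    f 0 * (g 0 * h (suc n) + (g′ ⊛ h) n) + (f′ ⊛ (g ⊛ h)) n
      ≈⟨ +-congʳ (*-congˡ (⊛-suc g h n)) ⟨
    f 0 * (g ⊛ h) (suc n) + (f′ ⊛ (g ⊛ h)) n
      ≈⟨ ⊛-suc f (g ⊛ h) n ⟨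
    (f ⊛ (g ⊛ h)) (suc n) ∎
    where
    f′ = λ i → f (suc i)
    g′ = λ i → g (suc i)
    f₀g′ = λ i → f 0 * g (suc i)

  const-⊛ : ∀ a f → const a ⊛ f ≋ (λ n → a * f n)
  const-⊛ a f zero    = refl
  const-⊛ a f (suc n) = begin
    (const a ⊛ f) (suc n)                             ≈⟨ ⊛-suc (const a) f n ⟩
    a * f (suc n) + sumTo (λ i → 0# * f (n ∸ i)) n    ≈⟨ +-congˡ (sumTo-cong n (λ i _ → zeroˡ _)) ⟩
    a * f (suc n) + sumTo (λ _ → 0#) n                ≈⟨ +-congˡ (sumTo-zero n) ⟩
    a * f (suc n) + 0#                                ≈⟨ +-identityʳ _ ⟩
    a * f (suc n)                                     ∎

  ⊛-identityˡ : ∀ f → const 1# ⊛ f ≋ f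
  ⊛-identityˡ f n = trans (const-⊛ 1# f n) (*-identityˡ _)

  seriesRing : CommutativeRing c ℓ
  seriesRing = record
    { Carrier = Ser
    ; _≈_ = _≋_
    ; _+_ = _⊕_
    ; _*_ = _⊛_
    ; -_ = λ f n → - f n
    ; 0# = λ _ → 0#
    ; 1# = const 1#
    ; isCommutativeRing = record
      { isRing = record
        { +-isAbelianGroup = record
          { isGroup = record
            { isMonoid = record
              { isSemigroup = record
                { isMagma = record
                  { isEquivalence = record
                    { refl = λ _ → refl
                    ; sym = λ f≋g n → sym (f≋g n)
                    ; trans = λ f≋g g≋h n → trans (f≋g n) (g≋h n) }
                  ; ∙-cong = λ f≋f′ g≋g′ n → +-cong (f≋f′ n) (g≋g′ n) }
                ; assoc = λ f g h n → +-assoc (f n) (g n) (h n) }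
              ; identity = (λ f n → +-identityˡ (f n)) , (λ f n → +-identityʳ (f n)) }
            ; inverse = (λ f n → -‿inverseˡ (f n)) , (λ f n → -‿inverseʳ (f n))
            ; ⁻¹-cong = λ f≋g n → -‿cong (f≋g n) }
          ; comm = λ f g n → +-comm (f n) (g n) }
        ; *-cong = ⊛-cong
        ; *-assoc = ⊛-assoc
        ; *-identity = ⊛-identityˡ , (λ f n → trans (⊛-comm f (const 1#) n) (⊛-identityˡ f n))
        ; distrib = (λ f g h n → trans (⊛-comm f (g ⊕ h) n)
                                  (trans (⊛-distribʳ g h f n) (+-cong (⊛-comm g f n) (⊛-comm h f n))))
                  , (λ h f g → ⊛-distribʳ f g h) }
      ; *-comm = ⊛-comm }
    }

  Z-⊛-zero : ∀ f → (Z ⊛ f) 0 ≈ 0#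
  Z-⊛-zero f = zeroˡ _

  Z-⊛-suc : ∀ f n → (Z ⊛ f) (suc n) ≈ f n
  Z-⊛-suc f n = begin
    (Z ⊛ f) (suc n)                             ≈⟨ ⊛-suc Z f n ⟩
    0# * f (suc n) + ((λ i → Z (suc i)) ⊛ f) n
      ≈⟨ +-cong (zeroˡ _) (⊛-cong {g = f} Z′≋1 (λ _ → refl) n) ⟩
    0# + (const 1# ⊛ f) n                       ≈⟨ +-identityˡ _ ⟩
    (const 1# ⊛ f) n                            ≈⟨ ⊛-identityˡ f n ⟩
    f n                                         ∎
    where
    Z′≋1 : (λ i → Z (suc i)) ≋ const 1#
    Z′≋1 zero    = refl
    Z′≋1 (suc i) = refl

  ⊛-vanishes-below : ∀ M f n → M 0 ≈ 0# → (∀ m → m < n → f m ≈ 0#) → (M ⊛ f) n ≈ 0#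
  ⊛-vanishes-below M f zero    M₀≈0 _   = trans (*-congʳ M₀≈0) (zeroˡ _)
  ⊛-vanishes-below M f (suc n) M₀≈0 f<n≈0 = begin
    (M ⊛ f) (suc n)                              ≈⟨ ⊛-suc M f n ⟩
    M 0 * f (suc n) + ((λ i → M (suc i)) ⊛ f) n
      ≈⟨ +-cong (trans (*-congʳ M₀≈0) (zeroˡ _)) (sumTo-cong n tail≈0) ⟩
    0# + sumTo (λ _ → 0#) n                      ≈⟨ trans (+-identityˡ _) (sumTo-zero n) ⟩
    0#                                           ∎
    where
    tail≈0 : ∀ i → i ≤ n → M (suc i) * f (n ∸ i) ≈ 0#
    tail≈0 i _ = trans (*-congˡ (f<n≈0 (n ∸ i) (s≤s (ℕ.m∸n≤m n i)))) (zeroʳ _)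

  contraction-vanishes : ∀ {I : Set} (D : I → Ser) (M N : Ser) (next : I → I) → M 0 ≈ 0# → N 0 ≈ 0# →
                         (∀ i → D i ≋ M ⊛ D i ⊕ N ⊛ D (next i)) → ∀ i → D i ≋ (λ _ → 0#)
  contraction-vanishes D M N next M₀≈0 N₀≈0 D≋MD+ND i n = <-rec (λ n → ∀ i → D i n ≈ 0#) step n i
    where
    step : ∀ n → (∀ {m} → m < n → ∀ i → D i m ≈ 0#) → ∀ i → D i n ≈ 0#
    step n below i = begin
      D i n                             ≈⟨ D≋MD+ND i n ⟩
      (M ⊛ D i) n + (N ⊛ D (next i)) n
        ≈⟨ +-cong (⊛-vanishes-below M (D i) n M₀≈0 (λ _ m<n → below m<n i))
                  (⊛-vanishes-below N (D (next i)) n N₀≈0 (λ _ m<n → below m<n (next i))) ⟩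
      0# + 0#                           ≈⟨ +-identityʳ 0# ⟩
      0#                                ∎

  private
    module 𝕊 = CommutativeRing seriesRing

  const-cong : ∀ {a b} → a ≈ b → const a ≋ const b
  const-cong a≈b zero    = a≈b
  const-cong a≈b (suc n) = refl

  const-+ : ∀ a b → const (a + b) ≋ const a 𝕊.+ const b
  const-+ a b zero    = refl
  const-+ a b (suc n) = sym (+-identityʳ 0#)

  const-‿ : ∀ a → const (- a) ≋ 𝕊.- const a
  const-‿ a zero    = refl
  const-‿ a (suc n) = sym -0#≈0#

  const-* : ∀ a b → const (a * b) ≋ const a 𝕊.* const b
  const-* a b n = sym (trans (const-⊛ a (const b) n) (lemma n))
    where
    lemma : ∀ n → a * const b n ≈ const (a * b) n
    lemma zero    = refl
    lemma (suc n) = zeroʳ a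

  const-ι₂ : const (ι 2) ≋ 𝕊.1# 𝕊.+ 𝕊.1#
  const-ι₂ = 𝕊.trans (const-+ 1# (1# + 0#)) (𝕊.+-congˡ (const-cong (+-identityʳ 1#)))

  Z⊛-from-coefficients : ∀ f g → f 0 ≈ 0# → (∀ n → f (suc n) ≈ g n) → f ≋ Z ⊛ g
  Z⊛-from-coefficients f g f₀≈0 f′≈g zero    = trans f₀≈0 (sym (Z-⊛-zero g))
  Z⊛-from-coefficients f g f₀≈0 f′≈g (suc n) = trans (f′≈g n) (sym (Z-⊛-suc g n))

  -- F k counts walks from distance k to a target, a step from distance k + 1 to k weighing w k.
  -- A walk from distance k + 1 first reaches distance k after an excursion counted by P/z,
  -- whence z F (k + 1) = w k P F k.  For the whole family, the difference D k of the two sides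
  -- satisfies D k = P D k + z D (k + 1), so D vanishes as P and z have no constant term.
  first-passage : ∀ (P : Ser) → P 0 ≈ 0# → P ≋ Z ⊛ Z ⊕ P ⊛ P →
                  ∀ (F : ℕ → Ser) (w : ℕ → Carrier) → (∀ k → w (suc k) ≈ 1#) →
                  (∀ k → F (suc k) ≋ Z ⊛ (F (suc (suc k)) ⊕ const (w k) ⊛ F k)) →
                  Z ⊛ F 1 ≋ const (w 0) ⊛ (P ⊛ F 0)
  first-passage P P₀≈0 P-eq F w w′≈1 F-eq =
    x∙y⁻¹≈ε⇒x≈y _ _ (contraction-vanishes D P Z suc P₀≈0 refl D-eq 0)
    where
    open import Algebra.Properties.Group 𝕊.+-group using (x∙y⁻¹≈ε⇒x≈y)
    D : ℕ → Ser
    D k = Z ⊛ F (suc k) 𝕊.- const (w k) ⊛ (P ⊛ F k)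
    D-eq : ∀ k → D k ≋ P ⊛ D k ⊕ Z ⊛ D (suc k)
    D-eq k = 𝕊.trans (first-passage-step {Z} {P} {const (w k)} {F k} {F (suc k)} {F (suc (suc k))} P-eq (F-eq k))
                     (𝕊.+-congˡ (𝕊.*-congˡ {Z} (𝕊.+-congˡ {Z ⊛ F (suc (suc k))} (𝕊.-‿cong P⊛F≋wP⊛F))))
      where
      open Identities seriesRing using (first-passage-step)
      P⊛F≋wP⊛F : P ⊛ F (suc k) ≋ const (w (suc k)) ⊛ (P ⊛ F (suc k))
      P⊛F≋wP⊛F = 𝕊.trans (𝕊.sym (𝕊.*-identityˡ (P ⊛ F (suc k))))
                          (𝕊.*-congʳ {P ⊛ F (suc k)} (𝕊.sym (const-cong (w′≈1 k))))

module Ballot {c ℓ} (R : CommutativeRing c ℓ) where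
  open CommutativeRing R hiding (zero)
  open Series R
  open PowerSeries R
  open import Algebra.Properties.Group +-group using (∙-cancelʳ)
  open import Relation.Binary.Reasoning.Setoid setoid
  private
    module 𝕊 = CommutativeRing seriesRing

  -- U n d: number of ±1-walks of length n from d to 0 that never go below 0
  U : ℕ → ℕ → Carrier
  U zero    zero    = 1#
  U zero    (suc d) = 0#
  U (suc n) zero    = U n 1
  U (suc n) (suc d) = U n (suc (suc d)) + U n d

  U-beyond-reach : ∀ n d → n < d → U n d ≈ 0#
  U-beyond-reach zero    (suc d) _         = refl
  U-beyond-reach (suc n) (suc d) (s≤s n<d) = begin
    U n (suc (suc d)) + U n d  ≈⟨ +-cong (U-beyond-reach n (suc (suc d)) (ℕ.m<n⇒m<1+n (ℕ.m<n⇒m<1+n n<d)))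
                                         (U-beyond-reach n d n<d) ⟩
    0# + 0#                    ≈⟨ +-identityʳ 0# ⟩
    0#                         ∎

  U-odd : ∀ n d → parity (n ℕ.+ d) ≡ 1ℙ → U n d ≈ 0#
  U-odd zero    (suc d) _   = refl
  U-odd (suc n) zero    odd = U-odd n 1 (≡.trans (≡.cong parity (ℕ.+-suc n 0)) odd)
  U-odd (suc n) (suc d) odd = begin
    U n (suc (suc d)) + U n d
      ≈⟨ +-cong (U-odd n (suc (suc d)) (≡.trans (≡.cong parity (ℕ.+-suc n (suc d))) odd))
                (U-odd n d (≡.trans (≡.cong (λ k → parity (suc k)) (≡.sym (ℕ.+-suc n d))) odd)) ⟩
    0# + 0#                    ≈⟨ +-identityʳ 0# ⟩
    0#                         ∎

  U-diagonal : ∀ a → U a a ≈ 1#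
  U-diagonal zero    = refl
  U-diagonal (suc a) = begin
    U a (suc (suc a)) + U a a
      ≈⟨ +-cong (U-beyond-reach a (suc (suc a)) (ℕ.m<n⇒m<1+n (ℕ.n<1+n a))) (U-diagonal a) ⟩
    0# + 1#                    ≈⟨ +-identityˡ 1# ⟩
    1#                         ∎

  ι-+ : ∀ m n → ι (m ℕ.+ n) ≈ ι m + ι n
  ι-+ zero    n = sym (+-identityˡ _)
  ι-+ (suc m) n = trans (+-congˡ (ι-+ m n)) (sym (+-assoc _ _ _))

  ι-pascal : ∀ n k → ι (suc n C suc k) ≈ ι (n C k) + ι (n C suc k)
  ι-pascal n k = trans (reflexive (≡.cong ι (Binomial.pascal n k))) (ι-+ (n C k) (n C suc k))

  ι-C-cong : ∀ n {k k′} → k ≡ k′ → ι (n C k) ≈ ι (n C k′)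
  ι-C-cong n k≡k′ = reflexive (≡.cong (λ k → ι (n C k)) k≡k′)

  -- The reflection principle, without subtraction: of the walks of length n = a + b from
  -- a - b to 0 (a = b + d), the C(n, a + 1) ones that go below 0 complement U n d to C(n, b).
  ballot : ∀ n b d → n ≡ b ℕ.+ (b ℕ.+ d) → U n d + ι (n C suc (b ℕ.+ d)) ≈ ι (n C b)
  ballot n zero d ≡.refl = +-cong (U-diagonal d) (reflexive (≡.cong ι (k>n⇒nCk≡0 (ℕ.n<1+n d))))
  ballot (suc n) (suc b) zero eq = begin
    U n 1 + ι (suc n C suc (suc (b ℕ.+ 0)))
      ≈⟨ +-congˡ (ι-pascal n (suc (b ℕ.+ 0))) ⟩
    U n 1 + (ι (n C suc (b ℕ.+ 0)) + ι (n C suc (suc (b ℕ.+ 0))))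
      ≈⟨ solve 3 (λ x y z → x :+ (y :+ z) := (x :+ z) :+ y) refl _ _ _ ⟩
    (U n 1 + ι (n C suc (suc (b ℕ.+ 0)))) + ι (n C suc (b ℕ.+ 0))
      ≈⟨ +-cong (trans (+-congˡ (ι-C-cong n (≡.cong suc (≡.sym (ℕ.+-suc b 0))))) (ballot n b 1 n≡b+[b+1]))
                (ι-C-cong n (≡.cong suc (ℕ.+-identityʳ b))) ⟩
    ι (n C b) + ι (n C suc b)
      ≈⟨ ι-pascal n b ⟨
    ι (suc n C suc b) ∎
    where
    open IntegerCoefficients R using (solve; _:=_; _:+_)
    n≡b+[b+1] : n ≡ b ℕ.+ (b ℕ.+ 1)
    n≡b+[b+1] = ≡.trans (ℕ.suc-injective eq) (≡.cong (b ℕ.+_) (≡.sym (ℕ.+-suc b 0)))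
  ballot (suc n) (suc b) (suc d) eq = begin
    (U n (suc (suc d)) + U n d) + ι (suc n C suc (suc (b ℕ.+ suc d)))
      ≈⟨ +-congˡ (ι-pascal n (suc (b ℕ.+ suc d))) ⟩
    (U n (suc (suc d)) + U n d) + (ι (n C suc (b ℕ.+ suc d)) + ι (n C suc (suc (b ℕ.+ suc d))))
      ≈⟨ solve 4 (λ x y z w → (x :+ y) :+ (z :+ w) := (x :+ w) :+ (y :+ z)) refl _ _ _ _ ⟩
    (U n (suc (suc d)) + ι (n C suc (suc (b ℕ.+ suc d)))) + (U n d + ι (n C suc (b ℕ.+ suc d)))
      ≈⟨ +-cong (trans (+-congˡ (ι-C-cong n (≡.cong suc (≡.sym (ℕ.+-suc b (suc d))))))
                       (ballot n b (suc (suc d)) n≡b+[b+2+d]))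
                (trans (+-congˡ (ι-C-cong n (≡.cong suc (ℕ.+-suc b d))))
                       (ballot n (suc b) d n≡1+b+[1+b+d])) ⟩
    ι (n C b) + ι (n C suc b)
      ≈⟨ ι-pascal n b ⟨
    ι (suc n C suc b) ∎
    where
    open IntegerCoefficients R using (solve; _:=_; _:+_)
    n≡b+[b+2+d] : n ≡ b ℕ.+ (b ℕ.+ suc (suc d))
    n≡b+[b+2+d] = ≡.trans (ℕ.suc-injective eq) (≡.cong (b ℕ.+_) (≡.sym (ℕ.+-suc b (suc d))))
    n≡1+b+[1+b+d] : n ≡ suc b ℕ.+ (suc b ℕ.+ d)
    n≡1+b+[1+b+d] = ≡.trans (ℕ.suc-injective eq)
                      (≡.trans (≡.cong (b ℕ.+_) (≡.cong suc (ℕ.+-suc b d))) (ℕ.+-suc b (suc (b ℕ.+ d))))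

  catalan-coefficient : ∀ m → U (m ℕ.+ m) 0 ≈ ι (((2 ℕ.* m) C m) / suc m)
  catalan-coefficient m = ∙-cancelʳ (ι ((m ℕ.+ m) C suc m)) _ _ (begin
    U (m ℕ.+ m) 0 + ι ((m ℕ.+ m) C suc m)
      ≈⟨ +-congˡ (ι-C-cong (m ℕ.+ m) (≡.cong suc (ℕ.+-identityʳ m))) ⟨
    U (m ℕ.+ m) 0 + ι ((m ℕ.+ m) C suc (m ℕ.+ 0))
      ≈⟨ ballot (m ℕ.+ m) m 0 (≡.cong (m ℕ.+_) (≡.sym (ℕ.+-identityʳ m))) ⟩
    ι ((m ℕ.+ m) C m)
      ≈⟨ reflexive (≡.cong ι (Binomial.catalan m)) ⟨
    ι (((2 ℕ.* m) C m) / suc m ℕ.+ (m ℕ.+ m) C suc m)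
      ≈⟨ ι-+ (((2 ℕ.* m) C m) / suc m) ((m ℕ.+ m) C suc m) ⟩
    ι (((2 ℕ.* m) C m) / suc m) + ι ((m ℕ.+ m) C suc m) ∎)

  Pz²-coefficient : ∀ k → Pz² (suc (suc k)) ≈ U k 0
  Pz²-coefficient k with k % 2 in k%2
  ... | zero  = sym (trans (reflexive (≡.cong (λ n → U n 0) k≡h+h)) (catalan-coefficient (k / 2)))
    where k≡h+h = n%2≡0⇒n≡[n/2]+[n/2] k k%2
  ... | suc _ = sym (U-odd k 0 (≡.trans (≡.cong parity k+0≡1+h+h) (parity[1+m+m]≡1 (k / 2))))
    where k+0≡1+h+h = ≡.trans (ℕ.+-identityʳ k) (n%2≡1+j⇒n≡1+[n/2]+[n/2] k k%2)

  Us : ℕ → Ser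
  Us d n = U n d

  E : Ser
  E = Us 0

  Us-zero : Us 0 ≋ const 1# ⊕ Z ⊛ Us 1
  Us-zero zero    = sym (trans (+-congˡ (Z-⊛-zero (Us 1))) (+-identityʳ 1#))
  Us-zero (suc n) = sym (trans (+-congˡ (Z-⊛-suc (Us 1) n)) (+-identityˡ _))

  Us-suc : ∀ d → Us (suc d) ≋ Z ⊛ (Us (suc (suc d)) ⊕ Us d)
  Us-suc d = Z⊛-from-coefficients (Us (suc d)) (Us (suc (suc d)) ⊕ Us d) refl (λ _ → refl)

  -- a walk from d + 1 first reaches d after an excursion counted by z E
  Us-first-passage : ∀ d → Z ⊛ (E ⊛ Us d) ≋ Us (suc d)
  Us-first-passage d       zero    = Z-⊛-zero (E ⊛ Us d)
  Us-first-passage zero    (suc n) = begin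
    (Z ⊛ (E ⊛ Us 0)) (suc n)    ≈⟨ Z-⊛-suc (E ⊛ Us 0) n ⟩
    (E ⊛ Us 0) n                ≈⟨ 𝕊.trans (𝕊.*-congˡ {E} Us-zero) expand n ⟩
    U n 0 + (Z ⊛ (E ⊛ Us 1)) n  ≈⟨ +-congˡ (Us-first-passage 1 n) ⟩
    U n 0 + U n 2               ≈⟨ +-comm _ _ ⟩
    U (suc n) 1                 ∎
    where
    open IntegerCoefficients seriesRing using (solve; _:=_; _:+_; _:*_; con)
    expand : E ⊛ (const 1# ⊕ Z ⊛ Us 1) ≋ E ⊕ Z ⊛ (E ⊛ Us 1)
    expand = solve 3 (λ e z u → e :* (con (+ 1) :+ z :* u) := e :+ z :* (e :* u)) 𝕊.refl E Z (Us 1)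
  Us-first-passage (suc d) (suc n) = begin
    (Z ⊛ (E ⊛ Us (suc d))) (suc n)
      ≈⟨ Z-⊛-suc (E ⊛ Us (suc d)) n ⟩
    (E ⊛ Us (suc d)) n
      ≈⟨ 𝕊.trans (𝕊.*-congˡ {E} (Us-suc d)) expand n ⟩
    (Z ⊛ (E ⊛ Us (suc (suc d)))) n + (Z ⊛ (E ⊛ Us d)) n
      ≈⟨ +-cong (Us-first-passage (suc (suc d)) n) (Us-first-passage d n) ⟩
    U (suc n) (suc (suc d)) ∎
    where
    open IntegerCoefficients seriesRing using (solve; _:=_; _:+_; _:*_)
    expand : E ⊛ (Z ⊛ (Us (suc (suc d)) ⊕ Us d)) ≋ Z ⊛ (E ⊛ Us (suc (suc d))) ⊕ Z ⊛ (E ⊛ Us d)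
    expand = solve 4 (λ e z a b → e :* (z :* (a :+ b)) := z :* (e :* a) :+ z :* (e :* b))
                     𝕊.refl E Z (Us (suc (suc d))) (Us d)

  E-equation : E ≋ const 1# ⊕ Z ⊛ (Z ⊛ (E ⊛ E))
  E-equation = 𝕊.trans Us-zero (𝕊.+-congˡ (𝕊.*-congˡ (𝕊.sym (Us-first-passage 0))))

  Pz²≋Z²E : Pz² ≋ Z ⊛ (Z ⊛ E)
  Pz²≋Z²E zero          = sym (Z-⊛-zero (Z ⊛ E))
  Pz²≋Z²E (suc zero)    = sym (trans (Z-⊛-suc (Z ⊛ E) 0) (Z-⊛-zero E))
  Pz²≋Z²E (suc (suc k)) = trans (Pz²-coefficient k) (sym (trans (Z-⊛-suc (Z ⊛ E) (suc k)) (Z-⊛-suc E k)))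

  catalan-series : Pz² ≋ Z ⊛ Z ⊕ Pz² ⊛ Pz²
  catalan-series = 𝕊.trans Pz²≋Z²E (𝕊.trans (Identities.catalan-equation seriesRing E-equation)
                     (𝕊.+-congˡ (𝕊.*-cong (𝕊.sym Pz²≋Z²E) (𝕊.sym Pz²≋Z²E))))

module WeightedWalks {c ℓ} (R : CommutativeRing c ℓ) (q : CommutativeRing.Carrier R) where
  open CommutativeRing R hiding (zero)
  open Series R using (qδ; g)
  open import Relation.Binary.Reasoning.Setoid setoid

  weight : ℤ → Carrier
  weight L = if isSpecial L then q else 1#

  -- W n L: total weight of the ±1-walks of length n from L to 0,
  -- a down-step from level L weighing `weight L`
  W : ℕ → ℤ → Carrier
  W zero    (+ zero)  = 1#
  W zero    (+ suc _) = 0#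
  W zero    -[1+ _ ]  = 0#
  W (suc n) L         = W n (ℤ.suc L) + weight L * W n (ℤ.pred L)

  W-suc-vanishes : ∀ n L → W n (ℤ.suc L) ≈ 0# → W n (ℤ.pred L) ≈ 0# → W (suc n) L ≈ 0#
  W-suc-vanishes n L up≈0 down≈0 = trans (+-cong up≈0 (trans (*-congˡ down≈0) (zeroʳ _))) (+-identityʳ 0#)

  W-beyond-reach : ∀ n L → n < ∣ L ∣ → W n L ≈ 0#
  W-beyond-reach zero    (+ suc k)    _         = refl
  W-beyond-reach zero    -[1+ k ]     _         = refl
  W-beyond-reach (suc n) (+ suc k)    (s≤s n<k) =
    W-suc-vanishes n (+ suc k) (W-beyond-reach n (+ suc (suc k)) (ℕ.m<n⇒m<1+n (ℕ.m<n⇒m<1+n n<k)))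
                               (W-beyond-reach n (+ k) n<k)
  W-beyond-reach (suc n) -[1+ suc k ] (s≤s n<k) =
    W-suc-vanishes n -[1+ suc k ] (W-beyond-reach n -[1+ k ] n<k)
                                  (W-beyond-reach n -[1+ suc (suc k) ] (ℕ.m<n⇒m<1+n (ℕ.m<n⇒m<1+n n<k)))

  W-odd : ∀ n L → parity (n ℕ.+ ∣ L ∣) ≡ 1ℙ → W n L ≈ 0#
  W-odd zero    (+ suc k) _   = refl
  W-odd zero    -[1+ k ]  _   = refl
  W-odd (suc n) L         odd =
    W-suc-vanishes n L (W-odd n (ℤ.suc L) (≡.trans (parity-suc-level n L) odd))
                       (W-odd n (ℤ.pred L) (≡.trans (parity-pred-level n L) odd))

  W-level-cong : ∀ n {L L′} → L ≡ L′ → W n L ≈ W n L′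
  W-level-cong n L≡L′ = reflexive (≡.cong (W n) L≡L′)

  W-suc-⊖ : ∀ n a b → W (suc n) (a ⊖ b) ≈ W n (suc a ⊖ b) + weight (a ⊖ b) * W n (a ⊖ suc b)
  W-suc-⊖ n a b = +-cong (W-level-cong n (ℤ.distribʳ-⊖-+-pos 1 a b))
                         (*-congˡ (W-level-cong n (ℤ.distribʳ-⊖-+-neg 0 a b)))

  qδ≡weight : ∀ m₁ m₂ → qδ q m₁ m₂ ≡ weight (m₁ ⊖ m₂)
  qδ≡weight m₁ m₂ = ≡.cong (if_then q else 1#) (δ-condition≡isSpecial m₁ m₂)

  g≈W : ∀ a b → g q a b ≈ W (a ℕ.+ b) (a ⊖ b)
  g≈W zero    zero    = refl
  g≈W (suc a) zero    = begin
    qδ q (suc a) 0 * g q a 0                   ≈⟨ *-cong (reflexive (qδ≡weight (suc a) 0)) (g≈W a 0) ⟩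
    weight (+ suc a) * W (a ℕ.+ 0) (+ a)       ≈⟨ +-identityˡ _ ⟨
    0# + weight (+ suc a) * W (a ℕ.+ 0) (+ a)  ≈⟨ +-congʳ (W-beyond-reach (a ℕ.+ 0) (+ suc (suc a)) a+0<2+a) ⟨
    W (suc (a ℕ.+ 0)) (+ suc a)                ∎
    where
    a+0<2+a : a ℕ.+ 0 < suc (suc a)
    a+0<2+a = ≡.subst (_< suc (suc a)) (≡.sym (ℕ.+-identityʳ a)) (ℕ.m<n⇒m<1+n (ℕ.n<1+n a))
  g≈W zero    (suc b) = begin
    g q 0 b
      ≈⟨ g≈W 0 b ⟩
    W b (0 ⊖ b)
      ≈⟨ +-identityʳ _ ⟨
    W b (0 ⊖ b) + 0#
      ≈⟨ +-cong (W-level-cong b (ℤ.[1+m]⊖[1+n]≡m⊖n 0 b))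
                (trans (*-identityˡ _) (W-beyond-reach b -[1+ suc b ] (ℕ.m<n⇒m<1+n (ℕ.n<1+n b)))) ⟨
    W b (1 ⊖ suc b) + 1# * W b (0 ⊖ suc (suc b))
      ≈⟨ W-suc-⊖ b 0 (suc b) ⟨
    W (suc b) (0 ⊖ suc b) ∎
  g≈W (suc a) (suc b) = begin
    qδ q (suc a) (suc b) * g q a (suc b) + g q (suc a) b
      ≈⟨ +-comm _ _ ⟩
    g q (suc a) b + qδ q (suc a) (suc b) * g q a (suc b)
      ≈⟨ +-cong (trans (g≈W (suc a) b)
                       (reflexive (≡.cong₂ W (≡.sym (ℕ.+-suc a b)) (≡.sym (ℤ.[1+m]⊖[1+n]≡m⊖n (suc a) b)))))
                (*-cong (reflexive (qδ≡weight (suc a) (suc b)))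
                        (trans (g≈W a (suc b)) (W-level-cong (a ℕ.+ suc b) (≡.sym (ℤ.[1+m]⊖[1+n]≡m⊖n a (suc b)))))) ⟩
    W (a ℕ.+ suc b) (suc (suc a) ⊖ suc b) + weight (suc a ⊖ suc b) * W (a ℕ.+ suc b) (suc a ⊖ suc (suc b))
      ≈⟨ W-suc-⊖ (a ℕ.+ suc b) (suc a) (suc b) ⟨
    W (suc (a ℕ.+ suc b)) (suc a ⊖ suc b) ∎

module WalkSeries {c ℓ} (R : CommutativeRing c ℓ) (q : CommutativeRing.Carrier R) where
  open CommutativeRing R hiding (zero)
  open Series R
  open PowerSeries R
  open WeightedWalks R q
  open Ballot R using (catalan-series)
  private
    module 𝕊 = CommutativeRing seriesRing

  walksFrom : ℤ → Ser
  walksFrom L n = W n L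

  walksFrom-origin : walksFrom (+ 0) ≋ const 1# ⊕ Z ⊛ (walksFrom (+ 1) ⊕ walksFrom -[1+ 0 ])
  walksFrom-origin zero    = sym (trans (+-congˡ (Z-⊛-zero first-steps)) (+-identityʳ 1#))
    where first-steps = walksFrom (+ 1) ⊕ walksFrom -[1+ 0 ]
  walksFrom-origin (suc n) =
    sym (trans (+-identityˡ _) (trans (Z-⊛-suc first-steps n) (+-congˡ (sym (*-identityˡ _)))))
    where first-steps = walksFrom (+ 1) ⊕ walksFrom -[1+ 0 ]

  walksFrom-away : ∀ L → W 0 L ≈ 0# →
                   walksFrom L ≋ Z ⊛ (walksFrom (ℤ.suc L) ⊕ const (weight L) ⊛ walksFrom (ℤ.pred L))
  walksFrom-away L W₀≈0 =
    Z⊛-from-coefficients _ _ W₀≈0 (λ n → +-congˡ (sym (const-⊛ (weight L) (walksFrom (ℤ.pred L)) n)))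

  above : ℕ → Ser
  above k = walksFrom (+ suc k)

  below : ℕ → Ser
  below k = walksFrom (ℤ.- (+ k))

  above-rec : ∀ k → above (suc k) ≋ Z ⊛ (above (suc (suc k)) ⊕ const (weight (+ suc (suc k))) ⊛ above k)
  above-rec k = walksFrom-away (+ suc (suc k)) refl

  below-rec : ∀ k → below (suc k) ≋ Z ⊛ (below (suc (suc k)) ⊕ const 1# ⊛ below k)
  below-rec k = 𝕊.trans (walksFrom-away -[1+ k ] refl) (𝕊.*-congˡ {Z} swap)
    where
    suc-negsuc : ∀ k → walksFrom (ℤ.suc -[1+ k ]) ≋ below k
    suc-negsuc zero    _ = refl
    suc-negsuc (suc k) _ = refl
    swap : walksFrom (ℤ.suc -[1+ k ]) ⊕ const 1# ⊛ below (suc (suc k))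
           ≋ below (suc (suc k)) ⊕ const 1# ⊛ below k
    swap n = trans (+-cong (suc-negsuc k n) (⊛-identityˡ (below (suc (suc k))) n))
                   (trans (+-comm _ _) (+-congˡ (sym (⊛-identityˡ (below k) n))))

  above-first-passage : Z ⊛ walksFrom (+ 2) ≋ const q ⊛ (Pz² ⊛ walksFrom (+ 1))
  above-first-passage =
    first-passage Pz² refl catalan-series above (λ k → weight (+ suc (suc k))) (λ _ → refl) above-rec

  below-first-passage : Z ⊛ walksFrom -[1+ 0 ] ≋ Pz² ⊛ walksFrom (+ 0)
  below-first-passage = 𝕊.trans (first-passage Pz² refl catalan-series below (λ _ → 1#) (λ _ → refl) below-rec)
                                (𝕊.*-identityˡ (Pz² ⊛ walksFrom (+ 0)))

  A B : Ser
  A = walksFrom (+ 0)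
  B = walksFrom (+ 1)

  open Identities.Elimination seriesRing {Z} {Pz²} {const q} {A} {B} {walksFrom -[1+ 0 ]} {walksFrom (+ 2)}
    catalan-series walksFrom-origin below-first-passage (walksFrom-away (+ 1) refl) above-first-passage
    public renaming (a-solution to A-solution; b-solution to B-solution)

module Theorem7 {c ℓ} (R : CommutativeRing c ℓ) (q u v : CommutativeRing.Carrier R)
                (uv≈1 : CommutativeRing._≈_ R (CommutativeRing._*_ R u v) (CommutativeRing.1# R)) where
  open CommutativeRing R hiding (zero)
  open Series R
  open PowerSeries R
  open WeightedWalks R q
  open WalkSeries R q public using (A; B; A-solution; B-solution)
  open import Relation.Binary.Reasoning.Setoid setoid
  private
    module 𝕊 = CommutativeRing seriesRing

  Q U V Q-1 two : Ser
  Q   = const q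
  U   = const u
  V   = const v
  Q-1 = Q 𝕊.- 𝕊.1#
  two = 𝕊.1# 𝕊.+ 𝕊.1#

  summand : ℕ → ℕ → Carrier
  summand n m = g q m (n ∸ m) * (pow u (n ∸ m) * pow v m)

  gPrev : ℕ → ℕ → Carrier
  gPrev j zero    = 0#
  gPrev j (suc m) = g q (suc j) m

  g-suc : ∀ j m → g q (suc j) m ≈ qδ q (suc j) m * g q j m + gPrev j m
  g-suc j zero    = sym (+-identityʳ _)
  g-suc j (suc m) = refl

  shifted : ℕ → ℕ → Carrier
  shifted n j = gPrev j (n ∸ j) * (pow u (n ∸ j) * pow v (suc j))

  summand-suc : ∀ n j → summand (suc n) (suc j) ≈ v * (qδ q (suc j) (n ∸ j) * summand n j) + shifted n j
  summand-suc n j = begin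
    g q (suc j) (n ∸ j) * (pow u (n ∸ j) * pow v (suc j))
      ≈⟨ *-congʳ (g-suc j (n ∸ j)) ⟩
    (qδ q (suc j) (n ∸ j) * g q j (n ∸ j) + gPrev j (n ∸ j)) * (pow u (n ∸ j) * pow v (suc j))
      ≈⟨ distribʳ _ _ _ ⟩
    (qδ q (suc j) (n ∸ j) * g q j (n ∸ j)) * (pow u (n ∸ j) * (v * pow v j)) + shifted n j
      ≈⟨ +-congʳ (solve 5 (λ d g pu v pv → (d :* g) :* (pu :* (v :* pv)) := v :* (d :* (g :* (pu :* pv))))
                          refl _ _ _ _ _) ⟩
    v * (qδ q (suc j) (n ∸ j) * summand n j) + shifted n j ∎
    where open IntegerCoefficients R using (solve; _:=_; _:*_)

  summand-zero : ∀ n → summand (suc n) 0 ≈ u * summand n 0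
  summand-zero n =
    solve 3 (λ g u pu → g :* ((u :* pu) :* con (+ 1)) := u :* (g :* (pu :* con (+ 1)))) refl (g q 0 n) u (pow u n)
    where open IntegerCoefficients R using (solve; _:=_; _:*_; con)

  shifted-sum : ∀ n → summand (suc n) 0 + sumTo (shifted n) n ≈ u * G̃ q u v n
  shifted-sum zero    = trans (+-cong (summand-zero 0) (zeroˡ _)) (+-identityʳ _)
  shifted-sum (suc n) = begin
    summand (suc (suc n)) 0 + (sumTo (shifted (suc n)) n + shifted (suc n) (suc n))
      ≈⟨ +-cong (summand-zero (suc n)) (+-cong (sumTo-cong n shifted-inner) shifted-last) ⟩
    u * summand (suc n) 0 + (sumTo (λ j → u * summand (suc n) (suc j)) n + 0#)
      ≈⟨ +-congˡ (trans (+-identityʳ _) (sym (sumTo-*ˡ u (λ j → summand (suc n) (suc j)) n))) ⟩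
    u * summand (suc n) 0 + u * sumTo (λ j → summand (suc n) (suc j)) n
      ≈⟨ distribˡ _ _ _ ⟨
    u * (summand (suc n) 0 + sumTo (λ j → summand (suc n) (suc j)) n)
      ≈⟨ *-congˡ (sumTo-suc (summand (suc n)) n) ⟨
    u * G̃ q u v (suc n) ∎
    where
    shifted-inner : ∀ j → j ≤ n → shifted (suc n) j ≈ u * summand (suc n) (suc j)
    shifted-inner j j≤n rewrite ℕ.+-∸-assoc 1 j≤n =
      solve 4 (λ g u pu pv → g :* ((u :* pu) :* pv) := u :* (g :* (pu :* pv))) refl _ u _ _
      where open IntegerCoefficients R using (solve; _:=_; _:*_)
    shifted-last : shifted (suc n) (suc n) ≈ 0#
    shifted-last rewrite ℕ.n∸n≡0 n = zeroˡ _

  H : ℕ → Carrier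
  H n = sumTo (λ j → qδ q (suc j) (n ∸ j) * summand n j) n

  G̃-suc : ∀ n → G̃ q u v (suc n) ≈ u * G̃ q u v n + v * H n
  G̃-suc n = begin
    sumTo (summand (suc n)) (suc n)
      ≈⟨ sumTo-suc (summand (suc n)) n ⟩
    summand (suc n) 0 + sumTo (λ j → summand (suc n) (suc j)) n
      ≈⟨ +-congˡ (trans (sumTo-cong n (λ j _ → summand-suc n j)) (sumTo-+ _ _ n)) ⟩
    summand (suc n) 0 + (sumTo (λ j → v * (qδ q (suc j) (n ∸ j) * summand n j)) n + sumTo (shifted n) n)
      ≈⟨ solve 3 (λ a b c → a :+ (b :+ c) := (a :+ c) :+ b) refl _ _ _ ⟩
    (summand (suc n) 0 + sumTo (shifted n) n) + sumTo (λ j → v * (qδ q (suc j) (n ∸ j) * summand n j)) n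
      ≈⟨ +-cong (shifted-sum n) (sym (sumTo-*ˡ v _ n)) ⟩
    u * G̃ q u v n + v * H n ∎
    where open IntegerCoefficients R using (solve; _:=_; _:+_)

  H-split : ∀ n → H n ≈ G̃ q u v n + (q - 1#) * summand n (suc n / 2)
  H-split n = begin
    H n
      ≈⟨ sumTo-cong n (λ j j≤n → trans (*-congʳ (trans (reflexive (qδ-middle j≤n)) (split _)))
                                        (distribʳ _ _ _)) ⟩
    sumTo (λ j → 1# * summand n j + δ (suc n / 2) (q - 1#) j * summand n j) n
      ≈⟨ sumTo-+ _ _ n ⟩
    sumTo (λ j → 1# * summand n j) n + sumTo (λ j → δ (suc n / 2) (q - 1#) j * summand n j) n
      ≈⟨ +-cong (sumTo-cong n (λ j _ → *-identityˡ _))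
                (sumTo-δ (suc n / 2) (q - 1#) (summand n) n middle≤n) ⟩
    G̃ q u v n + (q - 1#) * summand n (suc n / 2) ∎
    where
    open IntegerCoefficients R using (solve; _:=_; _:+_; _:-_; con)
    qδ-middle : ∀ {j} → j ≤ n → qδ q (suc j) (n ∸ j) ≡ (if suc n / 2 ≡ᵇ j then q else 1#)
    qδ-middle j≤n = ≡.cong (λ k → if suc k / 2 ≡ᵇ _ then q else 1#) (ℕ.m+[n∸m]≡n j≤n)
    split : ∀ b → (if b then q else 1#) ≈ 1# + (if b then q - 1# else 0#)
    split true  = solve 1 (λ q → q := con (+ 1) :+ (q :- con (+ 1))) refl q
    split false = sym (+-identityʳ 1#)
    middle≤n : suc n / 2 ≤ n
    middle≤n = ℕ.≤-pred (m/n<m (suc n) 2 (s≤s (s≤s z≤n)))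

  pow-cancel : ∀ m → pow u m * pow v m ≈ 1#
  pow-cancel zero    = *-identityˡ 1#
  pow-cancel (suc m) = begin
    (u * pow u m) * (v * pow v m)
      ≈⟨ solve 4 (λ u pu v pv → (u :* pu) :* (v :* pv) := (u :* v) :* (pu :* pv)) refl u _ v _ ⟩
    (u * v) * (pow u m * pow v m)
      ≈⟨ *-cong uv≈1 (pow-cancel m) ⟩
    1# * 1#
      ≈⟨ *-identityˡ 1# ⟩
    1# ∎
    where open IntegerCoefficients R using (solve; _:=_; _:*_)

  -- by parity, one of A n and B n vanishes
  summand-middle : ∀ n → summand n (suc n / 2) ≈ A n + v * B n
  summand-middle n with even-or-odd n
  ... | inj₁ (m , ≡.refl) = begin
    summand (m ℕ.+ m) (suc (m ℕ.+ m) / 2)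
      ≈⟨ reflexive (≡.cong (summand (m ℕ.+ m)) ([1+m+m]/2≡m m)) ⟩
    g q m (m ℕ.+ m ∸ m) * (pow u (m ℕ.+ m ∸ m) * pow v m)
      ≈⟨ reflexive (≡.cong (λ k → g q m k * (pow u k * pow v m)) (ℕ.m+n∸n≡m m m)) ⟩
    g q m m * (pow u m * pow v m)
      ≈⟨ *-cong (trans (g≈W m m) (W-level-cong (m ℕ.+ m) (ℤ.n⊖n≡0 m))) (pow-cancel m) ⟩
    W (m ℕ.+ m) (+ 0) * 1#
      ≈⟨ *-identityʳ _ ⟩
    W (m ℕ.+ m) (+ 0)
      ≈⟨ +-identityʳ _ ⟨
    W (m ℕ.+ m) (+ 0) + 0#
      ≈⟨ +-congˡ (trans (*-congˡ (W-odd (m ℕ.+ m) (+ 1) odd)) (zeroʳ v)) ⟨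
    W (m ℕ.+ m) (+ 0) + v * W (m ℕ.+ m) (+ 1) ∎
    where
    odd : parity (m ℕ.+ m ℕ.+ 1) ≡ 1ℙ
    odd = ≡.trans (≡.cong parity (ℕ.+-comm (m ℕ.+ m) 1)) (parity[1+m+m]≡1 m)
  ... | inj₂ (m , ≡.refl) = begin
    summand (suc (m ℕ.+ m)) (suc (suc (m ℕ.+ m)) / 2)
      ≈⟨ reflexive (≡.cong (summand (suc (m ℕ.+ m)))
                           (≡.trans ([2+n]/2≡1+n/2 (m ℕ.+ m)) (≡.cong suc ([m+m]/2≡m m)))) ⟩
    g q (suc m) (m ℕ.+ m ∸ m) * (pow u (m ℕ.+ m ∸ m) * pow v (suc m))
      ≈⟨ reflexive (≡.cong (λ k → g q (suc m) k * (pow u k * pow v (suc m))) (ℕ.m+n∸n≡m m m)) ⟩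
    g q (suc m) m * (pow u m * (v * pow v m))
      ≈⟨ *-cong (trans (g≈W (suc m) m) (W-level-cong (suc (m ℕ.+ m)) [1+m]⊖m≡1)) uᵐvᵐ⁺¹≈v ⟩
    W (suc (m ℕ.+ m)) (+ 1) * v
      ≈⟨ *-comm _ _ ⟩
    v * W (suc (m ℕ.+ m)) (+ 1)
      ≈⟨ +-identityˡ _ ⟨
    0# + v * W (suc (m ℕ.+ m)) (+ 1)
      ≈⟨ +-congʳ (W-odd (suc (m ℕ.+ m)) (+ 0) odd) ⟨
    W (suc (m ℕ.+ m)) (+ 0) + v * W (suc (m ℕ.+ m)) (+ 1) ∎
    where
    open IntegerCoefficients R using (solve; _:=_; _:*_)
    odd : parity (suc (m ℕ.+ m) ℕ.+ 0) ≡ 1ℙ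
    odd = ≡.trans (≡.cong parity (ℕ.+-identityʳ (suc (m ℕ.+ m)))) (parity[1+m+m]≡1 m)
    [1+m]⊖m≡1 : suc m ℤ.⊖ m ≡ + 1
    [1+m]⊖m≡1 = ≡.trans (≡.sym (ℤ.distribʳ-⊖-+-pos 1 m m)) (≡.cong ℤ.suc (ℤ.n⊖n≡0 m))
    uᵐvᵐ⁺¹≈v : pow u m * (v * pow v m) ≈ v
    uᵐvᵐ⁺¹≈v = trans (solve 3 (λ pu v pv → pu :* (v :* pv) := v :* (pu :* pv)) refl _ v _)
                     (trans (*-congˡ (pow-cancel m)) (*-identityʳ v))

  const-q-1 : const (q - 1#) ≋ Q-1
  const-q-1 = 𝕊.trans (const-+ q (- 1#)) (𝕊.+-congˡ (const-‿ 1#))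

  G̃-equation : G̃ q u v ≋ 𝕊.1# ⊕ Z ⊛ (U ⊛ G̃ q u v ⊕ V ⊛ G̃ q u v ⊕ V ⊛ (Q-1 ⊛ (A ⊕ V ⊛ B)))
  G̃-equation zero    = sym (trans (+-congˡ (Z-⊛-zero X)) (trans (+-identityʳ 1#) (sym G̃₀≈1)))
    where
    X = U ⊛ G̃ q u v ⊕ V ⊛ G̃ q u v ⊕ V ⊛ (Q-1 ⊛ (A ⊕ V ⊛ B))
    G̃₀≈1 : G̃ q u v 0 ≈ 1#
    G̃₀≈1 = trans (*-identityˡ _) (*-identityˡ 1#)
  G̃-equation (suc n) = begin
    G (suc n)
      ≈⟨ G̃-suc n ⟩
    u * G n + v * H n
      ≈⟨ +-congˡ (*-congˡ (trans (H-split n) (+-congˡ (*-congˡ (summand-middle n))))) ⟩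
    u * G n + v * (G n + (q - 1#) * (A n + v * B n))
      ≈⟨ solve 6 (λ u v r g a b → u :* g :+ v :* (g :+ r :* (a :+ v :* b))
                                   := u :* g :+ v :* g :+ v :* (r :* (a :+ v :* b)))
                 refl u v (q - 1#) (G n) (A n) (B n) ⟩
    u * G n + v * G n + v * ((q - 1#) * (A n + v * B n))
      ≈⟨ +-cong (+-cong (const-⊛ u G n) (const-⊛ v G n))
                (trans (const-⊛ v (Q-1 ⊛ (A ⊕ V ⊛ B)) n) (*-congˡ r-coefficient)) ⟨
    X n
      ≈⟨ Z-⊛-suc X n ⟨
    (Z ⊛ X) (suc n)
      ≈⟨ +-identityˡ _ ⟨
    0# + (Z ⊛ X) (suc n) ∎
    where
    open IntegerCoefficients R using (solve; _:=_; _:+_; _:*_)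
    G = G̃ q u v
    X = U ⊛ G ⊕ V ⊛ G ⊕ V ⊛ (Q-1 ⊛ (A ⊕ V ⊛ B))
    r-coefficient : (Q-1 ⊛ (A ⊕ V ⊛ B)) n ≈ (q - 1#) * (A n + v * B n)
    r-coefficient = trans (⊛-cong {g = A ⊕ V ⊛ B} (𝕊.sym const-q-1) 𝕊.refl n)
                          (trans (const-⊛ (q - 1#) (A ⊕ V ⊛ B) n) (*-congˡ (+-congˡ (const-⊛ v B n))))

  const-2q : const (ι 2 * q) ≋ two ⊛ Q
  const-2q = 𝕊.trans (const-* (ι 2) q) (⊛-cong const-ι₂ (𝕊.refl {Q}))

  const-q[q-1] : const (q * (q - 1#)) ≋ Q ⊛ Q-1
  const-q[q-1] = 𝕊.trans (const-* q (q - 1#)) (⊛-cong (𝕊.refl {Q}) const-q-1)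

  Den-≋ : Den q u ≋ Z ⊛ U ⊛ (Z ⊛ (U ⊛ U) 𝕊.- U ⊕ Z) ⊛ (𝕊.1# 𝕊.- two ⊛ Q ⊛ Pz²)
  Den-≋ = ⊛-cong (⊛-cong (𝕊.refl {Z ⊛ U}) quadratic)
                 (𝕊.+-congˡ {𝕊.1#} (𝕊.-‿cong (⊛-cong const-2q (𝕊.refl {Pz²}))))
    where
    quadratic : Z ⊛ const (u * u) 𝕊.- U ⊕ Z ≋ Z ⊛ (U ⊛ U) 𝕊.- U ⊕ Z
    quadratic = 𝕊.+-congʳ (𝕊.+-congʳ (⊛-cong (𝕊.refl {Z}) (const-* u u)))

  Num-≋ : Num q u ≋ (two ⊛ Q ⊛ U ⊛ U ⊛ Z ⊕ Q-1 ⊛ Q-1 ⊛ U 𝕊.- Q ⊛ Q-1 ⊛ Z) ⊛ Pz²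
                    𝕊.- Z ⊛ U ⊛ (U ⊕ Q ⊛ Q-1 ⊛ Z)
  Num-≋ = 𝕊.+-cong (⊛-cong coefficient (𝕊.refl {Pz²}))
                   (𝕊.-‿cong (⊛-cong (𝕊.refl {Z ⊛ U}) (𝕊.+-congˡ {U} q[q-1]z)))
    where
    q[q-1]z : const (q * (q - 1#)) ⊛ Z ≋ Q ⊛ Q-1 ⊛ Z
    q[q-1]z = ⊛-cong const-q[q-1] (𝕊.refl {Z})
    [q-1]²u : const ((q - 1#) * (q - 1#) * u) ≋ Q-1 ⊛ Q-1 ⊛ U
    [q-1]²u = 𝕊.trans (const-* ((q - 1#) * (q - 1#)) u)
                (⊛-cong (𝕊.trans (const-* (q - 1#) (q - 1#)) (⊛-cong const-q-1 const-q-1)) (𝕊.refl {U}))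
    2quuz : const (ι 2 * q * u * u) ⊛ Z ≋ two ⊛ Q ⊛ U ⊛ U ⊛ Z
    2quuz = ⊛-cong (𝕊.trans (const-* (ι 2 * q * u) u) (⊛-cong (𝕊.trans (const-* (ι 2 * q) u)
              (⊛-cong const-2q (𝕊.refl {U}))) (𝕊.refl {U}))) (𝕊.refl {Z})
    coefficient : const (ι 2 * q * u * u) ⊛ Z ⊕ const ((q - 1#) * (q - 1#) * u) 𝕊.- const (q * (q - 1#)) ⊛ Z
                  ≋ two ⊛ Q ⊛ U ⊛ U ⊛ Z ⊕ Q-1 ⊛ Q-1 ⊛ U 𝕊.- Q ⊛ Q-1 ⊛ Z
    coefficient = 𝕊.+-cong (𝕊.+-cong 2quuz [q-1]²u) (𝕊.-‿cong q[q-1]z)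

  U⊛V≋1 : U ⊛ V ≋ 𝕊.1#
  U⊛V≋1 = 𝕊.trans (𝕊.sym (const-* u v)) (const-cong uv≈1)

mainTheorem7 : ∀ {c ℓ : Level} (R : CommutativeRing c ℓ) → Thm7 R
mainTheorem7 R q u v uv≈1 =
  trans (⊛-cong (refl {G̃ q u v}) Den-≋)
        (trans (closed-form {Z} {Pz²} {Q} {U} {V} {G̃ q u v} {A} {B} U⊛V≋1 G̃-equation A-solution B-solution)
               (sym Num-≋))
  where
  open Series R using (G̃; Z; Pz²)
  open PowerSeries R using (seriesRing; ⊛-cong)
  open CommutativeRing seriesRing using (refl; trans; sym)
  open Identities seriesRing using (closed-form)
  open Theorem7 R q u v uv≈1
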